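{- Let $(a_n)_{n=0}^\infty$ be a sequence of integers such that $a_0>0$, $a_1\ge 1$, $a_0\le a_1$, $a_n=a_{n-1}+a_{n-2}$ for all $n\ge 2$, and $a_0^2+a_1a_0-a_1^2>0$. Then for all $n\ge 0$, $$\frac{1}{a_{2n+2}}-\frac{1}{a_{2n+3}}-\frac{1}{a_{2n+5}}>0.$$ -}

module Defs where

open import Data.Nat using (ℕ; zero; suc)
open import Data.Integer using (ℤ; +_; +[1+_]; -[1+_])
open import Data.Rational using (ℚ; _/_; 0ℚ)

-- Convention recip 0 = 0 (only to make the function total; in the theorem
-- all the arguments are provably positive, so this case never matters).
recip : ℤ → ℚ
recip (+ zero)    = 0ℚ
recip +[1+ n ]    = + 1 / suc n
recip -[1+ n ]    = -[1+ 0 ] / suc n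

-- With x = a₂ₙ₊₂, y = a₂ₙ₊₃ and z = a₂ₙ₊₅ = 2y + x, clearing the (positive)
-- denominators shows that 1/x − 1/y − 1/z has the sign of
-- (y − x) z − x y = 2 (y² − y x − x²) + x².
-- The Cassini form aₖ₊₁² − aₖ₊₁ aₖ − aₖ² changes sign from one index to the
-- next, so at the even index 2n + 2 it equals a₁² − a₁ a₀ − a₀²; together with
-- x ≥ a₂ = a₁ + a₀ this bounds the numerator below by 3 a₁² − a₀² > 0.
module Submission where

open import Defs
open import Data.Nat using (ℕ; suc; zero; _≤′_; ≤′-refl; ≤′-step) renaming (_+_ to _+ℕ_; _*_ to _*ℕ_; _≤_ to _≤ℕ_)
import Data.Nat.Properties as ℕ
open import Data.Integer using (ℤ; _+_; _*_; _-_; _<_; _≤_; +_; -_; +[1+_]; +<+)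
import Data.Integer.Base as ℤ
import Data.Integer.Properties as ℤ
open import Data.Integer.Tactic.RingSolver using (solve-∀)
open import Data.Rational using (0ℚ; toℚᵘ) renaming (_-_ to _-ℚ_; _<_ to _<ℚ_)
import Data.Rational as ℚ
open import Data.Rational.Properties using (toℚᵘ-homo-+; toℚᵘ-homo‿-; toℚᵘ-fromℚᵘ; toℚᵘ-cancel-<)
open import Data.Rational.Unnormalised using (ℚᵘ; ↥_; _≃_) renaming (_/_ to _/ᵘ_; _-_ to _-ᵘ_)
import Data.Rational.Unnormalised.Properties as ℚᵘ
open import Relation.Binary.PropositionalEquality using (_≡_; refl; sym; trans; cong; subst; module ≡-Reasoning)

toℚᵘ-homo-− : ∀ p q → toℚᵘ (p -ℚ q) ≃ toℚᵘ p -ᵘ toℚᵘ q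
toℚᵘ-homo-− p q = ℚᵘ.≃-trans (toℚᵘ-homo-+ p (ℚ.- q)) (ℚᵘ.+-congʳ (toℚᵘ p) (toℚᵘ-homo‿- q))

toℚᵘ-recip : ∀ n → toℚᵘ (recip +[1+ n ]) ≃ + 1 /ᵘ suc n
toℚᵘ-recip n = toℚᵘ-fromℚᵘ (+ 1 /ᵘ suc n)

unnormalised-gap-numerator : ∀ x y z → (+ 1 * y + - + 1 * x) * z + - + 1 * (x * y) ≡ (y - x) * z - x * y
unnormalised-gap-numerator = solve-∀

0<recip-gap : ∀ {x y z} → + 0 < x → + 0 < y → + 0 < z → + 0 < (y - x) * z - x * y
            → 0ℚ <ℚ (recip x -ℚ recip y) -ℚ recip z
0<recip-gap {+[1+ p ]} {+[1+ q ]} {+[1+ r ]} _ _ _ 0<numerator =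
  toℚᵘ-cancel-< (ℚᵘ.<-respʳ-≃ (ℚᵘ.≃-sym toℚᵘ-gap) (ℚᵘ.positive⁻¹ gap {{ℤ.positive 0<↥gap}}))
  where
  gap : ℚᵘ
  gap = (+ 1 /ᵘ suc p -ᵘ + 1 /ᵘ suc q) -ᵘ + 1 /ᵘ suc r

  toℚᵘ-gap : toℚᵘ ((recip +[1+ p ] -ℚ recip +[1+ q ]) -ℚ recip +[1+ r ]) ≃ gap
  toℚᵘ-gap = ℚᵘ.≃-trans (toℚᵘ-homo-− (recip +[1+ p ] -ℚ recip +[1+ q ]) (recip +[1+ r ]))
    (ℚᵘ.+-cong (ℚᵘ.≃-trans (toℚᵘ-homo-− (recip +[1+ p ]) (recip +[1+ q ]))
                           (ℚᵘ.+-cong (toℚᵘ-recip p) (ℚᵘ.-‿cong (toℚᵘ-recip q))))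
               (ℚᵘ.-‿cong (toℚᵘ-recip r)))

  -- ↥ gap unfolds to the left-hand side of unnormalised-gap-numerator, except that
  -- the denominator (1 + p) (1 + q) of the inner difference is a product in ℕ.
  ↥gap : ↥ gap ≡ (+[1+ q ] - +[1+ p ]) * +[1+ r ] - +[1+ p ] * +[1+ q ]
  ↥gap = trans (cong (λ d → (+ 1 * +[1+ q ] + - + 1 * +[1+ p ]) * +[1+ r ] + - + 1 * d) (ℤ.pos-* (suc p) (suc q)))
               (unnormalised-gap-numerator +[1+ p ] +[1+ q ] +[1+ r ])

  0<↥gap : + 0 < ↥ gap
  0<↥gap = subst (+ 0 <_) (sym ↥gap) 0<numerator
0<recip-gap {+ zero} (+<+ ())
0<recip-gap {+[1+ _ ]} {+ zero} _ (+<+ ())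
0<recip-gap {+[1+ _ ]} {+[1+ _ ]} {+ zero} _ _ (+<+ ())

cassini-shift : ∀ x y → (y + x) * (y + x) - (y + x) * y - y * y ≡ - (y * y - y * x - x * x)
cassini-shift = solve-∀

reciprocal-gap-cassini : ∀ x y → (y - x) * ((y + x) + y) - x * y ≡ (y * y - y * x - x * x) + (y * y - y * x - x * x) + x * x
reciprocal-gap-cassini = solve-∀

cassini-square-split : ∀ p q x → (q * q - q * p - p * p) + (q * q - q * p - p * p) + x * x
                     ≡ (x * x - (q + p) * (q + p)) + ((q * q - p * p) + (q * q + q * q))
cassini-square-split = solve-∀

square-mono-≤ : ∀ {i j} → + 0 ≤ i → i ≤ j → i * i ≤ j * j
square-mono-≤ {i} {j} 0≤i i≤j =
  ℤ.≤-trans (ℤ.*-monoˡ-≤-nonNeg i {{ℤ.nonNegative 0≤i}} i≤j)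
            (ℤ.*-monoʳ-≤-nonNeg j {{ℤ.nonNegative (ℤ.≤-trans 0≤i i≤j)}} i≤j)

0<2cassini+square : ∀ {p q x} → + 0 < p → p ≤ q → q + p ≤ x
                  → + 0 < (q * q - q * p - p * p) + (q * q - q * p - p * p) + x * x
0<2cassini+square {p} {q} {x} 0<p p≤q q+p≤x = begin-strict
  + 0                                                               <⟨ ℤ.+-mono-≤-< x²≥[q+p]² (ℤ.+-mono-≤-< q²≥p² 2q²>0) ⟩
  (x * x - (q + p) * (q + p)) + ((q * q - p * p) + (q * q + q * q)) ≡⟨ cassini-square-split p q x ⟨
  (q * q - q * p - p * p) + (q * q - q * p - p * p) + x * x         ∎
  where
  open ℤ.≤-Reasoning
  0<q : + 0 < q
  0<q = ℤ.<-≤-trans 0<p p≤q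
  x²≥[q+p]² : + 0 ≤ x * x - (q + p) * (q + p)
  x²≥[q+p]² = ℤ.i≤j⇒0≤j-i (square-mono-≤ (ℤ.<⇒≤ (ℤ.+-mono-< 0<q 0<p)) q+p≤x)
  q²≥p² : + 0 ≤ q * q - p * p
  q²≥p² = ℤ.i≤j⇒0≤j-i (square-mono-≤ (ℤ.<⇒≤ 0<p) p≤q)
  q²>0 : + 0 < q * q
  q²>0 = subst (_< q * q) (ℤ.*-zeroʳ q) (ℤ.*-monoˡ-<-pos q {{ℤ.positive 0<q}} 0<q)
  2q²>0 : + 0 < q * q + q * q
  2q²>0 = ℤ.+-mono-< q²>0 q²>0

module FibonacciLike (a : ℕ → ℤ) (rec : ∀ n → a (suc (suc n)) ≡ a (suc n) + a n) where

  cassini : ℕ → ℤ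
  cassini k = a (suc k) * a (suc k) - a (suc k) * a k - a k * a k

  cassini-suc : ∀ k → cassini (suc k) ≡ - cassini k
  cassini-suc k = trans (cong (λ s → s * s - s * a (suc k) - a (suc k) * a (suc k)) (rec k))
                        (cassini-shift (a k) (a (suc k)))

  cassini-+2 : ∀ k → cassini (2 +ℕ k) ≡ cassini k
  cassini-+2 k = begin
    cassini (suc (suc k)) ≡⟨ cassini-suc (suc k) ⟩
    - cassini (suc k)     ≡⟨ cong -_ (cassini-suc k) ⟩
    - - cassini k         ≡⟨ ℤ.neg-involutive (cassini k) ⟩
    cassini k             ∎
    where open ≡-Reasoning

  cassini-even : ∀ n → cassini (2 *ℕ n) ≡ cassini 0
  cassini-even zero    = refl
  cassini-even (suc n) = begin
    cassini (2 *ℕ suc n)    ≡⟨ cong cassini (ℕ.*-suc 2 n) ⟩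
    cassini (2 +ℕ 2 *ℕ n)   ≡⟨ cassini-+2 (2 *ℕ n) ⟩
    cassini (2 *ℕ n)        ≡⟨ cassini-even n ⟩
    cassini 0               ∎
    where open ≡-Reasoning

  reciprocal-gap-numerator : ∀ k → (a (suc k) - a k) * a (3 +ℕ k) - a k * a (suc k) ≡ cassini k + cassini k + a k * a k
  reciprocal-gap-numerator k =
    trans (cong (λ z → (a (suc k) - a k) * z - a k * a (suc k)) a[3+k])
          (reciprocal-gap-cassini (a k) (a (suc k)))
    where
    a[3+k] : a (3 +ℕ k) ≡ (a (suc k) + a k) + a (suc k)
    a[3+k] = trans (rec (suc k)) (cong (_+ a (suc k)) (rec k))

  module Increasing (0<a₀ : + 0 < a 0) (a₀≤a₁ : a 0 ≤ a 1) where

    mutual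
      0<a : ∀ k → + 0 < a k
      0<a zero    = 0<a₀
      0<a (suc k) = ℤ.<-≤-trans (0<a k) (a-increasing k)

      a-increasing : ∀ k → a k ≤ a (suc k)
      a-increasing zero    = a₀≤a₁
      a-increasing (suc k) =
        subst (a (suc k) ≤_) (sym (rec k)) (ℤ.i≤i+j (a (suc k)) (a k) {{ℤ.nonNegative (ℤ.<⇒≤ (0<a k))}})

    a-mono-≤ : ∀ {j k} → j ≤ℕ k → a j ≤ a k
    a-mono-≤ j≤k = mono′ (ℕ.≤⇒≤′ j≤k)
      where
      mono′ : ∀ {j k} → j ≤′ k → a j ≤ a k
      mono′ ≤′-refl        = ℤ.≤-refl
      mono′ (≤′-step j≤′k) = ℤ.≤-trans (mono′ j≤′k) (a-increasing _)

lemma2p6 : (a : ℕ → ℤ) → + 0 < a 0 → + 1 ≤ a 1 → a 0 ≤ a 1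
         → (∀ n → a (suc (suc n)) ≡ a (suc n) + a n)
         → + 0 < a 0 * a 0 + a 1 * a 0 - a 1 * a 1
         → ∀ n → 0ℚ <ℚ ((recip (a (2 *ℕ n +ℕ 2)) -ℚ recip (a (2 *ℕ n +ℕ 3))) -ℚ recip (a (2 *ℕ n +ℕ 5)))
lemma2p6 a 0<a₀ _ a₀≤a₁ rec _ n
  rewrite ℕ.+-comm (2 *ℕ n) 2 | ℕ.+-comm (2 *ℕ n) 3 | ℕ.+-comm (2 *ℕ n) 5 =
  0<recip-gap (0<a k) (0<a (suc k)) (0<a (3 +ℕ k)) (begin-strict
    + 0                                              <⟨ 0<2cassini+square 0<a₀ a₀≤a₁ a₁+a₀≤aₖ ⟩
    cassini 0 + cassini 0 + a k * a k                ≡⟨ cong (λ c → c + c + a k * a k) cassini-k ⟨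
    cassini k + cassini k + a k * a k                ≡⟨ reciprocal-gap-numerator k ⟨
    (a (suc k) - a k) * a (3 +ℕ k) - a k * a (suc k) ∎)
  where
  open FibonacciLike a rec
  open Increasing 0<a₀ a₀≤a₁
  open ℤ.≤-Reasoning
  k : ℕ
  k = 2 +ℕ 2 *ℕ n
  cassini-k : cassini k ≡ cassini 0
  cassini-k = trans (cassini-+2 (2 *ℕ n)) (cassini-even n)
  a₁+a₀≤aₖ : a 1 + a 0 ≤ a k
  a₁+a₀≤aₖ = subst (_≤ a k) (rec 0) (a-mono-≤ (ℕ.m≤m+n 2 (2 *ℕ n)))
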